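{- For all $n \ge 1$, all $k \ge 2$, and all $i$ with $1 \le i \le k-1$, the map $$\sigma \mapsto n-1,\ n-2,\ \ldots,\ n-i+1,\ n,\ \sigma$$ is a bijection from $S_{n-i}(123, 132, (k-1)(k-2)\ldots 1\,k)$ onto the set of $\pi \in S_n(123, 132, (k-1)(k-2)\ldots 1\,k)$ with $\pi^{ -1}(n) = i$. (For $i=1$ the map is $\sigma\mapsto n,\sigma$.)
   Context: Permutations of $[n]$ are written in one-line notation, and $S_n$ denotes the set of them; $\pi^{ -1}(n)$ is the position of the entry $n$. A permutation $\pi\in S_n$ contains $\sigma\in S_m$ if there are indices $i_1<\dots<i_m$ such that for all $a,b$, $\pi(i_a)<\pi(i_b)$ iff $\sigma(a)<\sigma(b)$; otherwise $\pi$ avoids $\sigma$. For a set $R$ of permutations, $S_n(R)$ is the set of $\pi\in S_n$ avoiding every element of $R$. By convention $S_0(R)$ consists of the empty permutation only and $S_m(R)=\emptyset$ for $m<0$. The permutation $(k-1)(k-2)\ldots 1\,k\in S_k$ lists $k-1,\dots,1$ in decreasing order followed by $k$. -}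

module Defs where

open import Data.Nat using (ℕ; zero; suc; _+_; _∸_; _<_; _≤_)
open import Data.List using (List; []; _∷_; _++_; map; length; lookup; upTo; downFrom)
open import Data.List.Relation.Binary.Permutation.Propositional using (_↭_)
open import Data.List.Relation.Binary.Sublist.Propositional using (_⊆_)
open import Data.List.Relation.Unary.All using (All)
open import Data.Fin using (Fin; toℕ; cast)
open import Data.Product using (Σ; ∃; _×_)
open import Relation.Binary.PropositionalEquality using (_≡_)
open import Relation.Nullary using (¬_)

oneTo : ℕ → List ℕ
oneTo n = map suc (upTo n)

IsPerm : ℕ → List ℕ → Set
IsPerm n xs = xs ↭ oneTo n

OrderIso : List ℕ → List ℕ → Set
OrderIso ys σ =
  Σ (length ys ≡ length σ) λ eq →
    ∀ (a b : Fin (length ys)) →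
      (lookup ys a < lookup ys b → lookup σ (cast eq a) < lookup σ (cast eq b)) ×
      (lookup σ (cast eq a) < lookup σ (cast eq b) → lookup ys a < lookup ys b)

Contains : List ℕ → List ℕ → Set
Contains π σ = ∃ λ ys → (ys ⊆ π) × OrderIso ys σ

AvoidsAll : List (List ℕ) → List ℕ → Set
AvoidsAll R π = All (λ σ → ¬ Contains π σ) R

InS : ℕ → List (List ℕ) → List ℕ → Set
InS n R π = IsPerm n π × AvoidsAll R π

PosIs : List ℕ → ℕ → ℕ → Set
PosIs π v i = ∃ λ (j : Fin (length π)) → (suc (toℕ j) ≡ i) × (lookup π j ≡ v)

decPat : ℕ → List ℕ
decPat k = map suc (downFrom (k ∸ 1)) ++ (k ∷ [])

R : ℕ → List (List ℕ)
R k = (1 ∷ 2 ∷ 3 ∷ []) ∷ (1 ∷ 3 ∷ 2 ∷ []) ∷ decPat k ∷ []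

prefix : ℕ → ℕ → List ℕ
prefix n i = map (λ j → (n ∸ i) + suc j) (downFrom (i ∸ 1)) ++ (n ∷ [])

φ : ℕ → ℕ → List ℕ → List ℕ
φ n i σ = prefix n i ++ σ

-- domain S_{n-i}(R) (empty when n-i < 0, per the convention S_m = ∅ for m<0)
Dom : ℕ → ℕ → ℕ → List ℕ → Set
Dom n k i σ = (i ≤ n) × InS (n ∸ i) (R k) σ

Cod : ℕ → ℕ → ℕ → List ℕ → Set
Cod n k i π = InS n (R k) π × PosIs π n i

-- Write π = xs ++ n ∷ σ. An ascent x < y with x in front of n completes to a 123 or a 132
-- together with n, so avoiding both forces every entry of xs to dominate everything after
-- it; as π is a permutation, xs must be n-1, …, n-i+1 and σ a permutation of [n-i], which
-- avoids the patterns because it is a subsequence of π. Conversely, each pattern of R has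
-- its first entry below its last, so an occurrence in (prefix ++ σ) cannot start in the
-- prefix, whose entries all exceed those of σ, and end in σ; it cannot lie inside the
-- prefix either, which is decreasing up to its final n (no 123, 132) and has i < k entries.
module Submission where

open import Defs
open import Data.Nat using (ℕ; zero; suc; _+_; _∸_; _<_; _≤_; _>_; s≤s; z<s; s<s)
open import Data.Nat.Properties
  using (≤-refl; ≤-antisym; <-trans; ≤-pred; <-asym; <-irrefl; <-≤-trans; ≤-<-trans; m<m+n; +-monoʳ-<;
         ≮⇒≥; +-suc; +-identityʳ; m∸n+n≡m; m≤m+n; suc-injective; module ≤-Reasoning)
open import Data.List using (List; []; _∷_; _++_; map; length; lookup; upTo; downFrom)
open import Data.List.Properties
  using (length-map; length-upTo; length-downFrom; length-++-≤ˡ; length-++-sucʳ;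
         map-++; upTo-∷ʳ; ++-assoc; ++-identityʳ; ++-cancelˡ)
open import Data.List.Membership.Propositional using (_∈_)
open import Data.List.Membership.Propositional.Properties using (∈-++⁻; ∈-lookup; ∈-map⁺; ∈-upTo⁺; ∈-upTo⁻)
open import Data.List.Relation.Unary.Any using (here; there)
open import Data.List.Relation.Unary.All as All using (All; []; _∷_)
import Data.List.Relation.Unary.All.Properties as All
open import Data.List.Relation.Unary.AllPairs as AllPairs using (AllPairs; []; _∷_)
import Data.List.Relation.Unary.AllPairs.Properties as AllPairs
open import Data.List.Relation.Binary.Sublist.Propositional using (_⊆_; []; _∷_; _∷ʳ_; ⊆-refl; ⊆-trans; from∈)
open import Data.List.Relation.Binary.Sublist.Propositional.Properties
  using (All-resp-⊆; ++⁺; ++⁺ˡ; []⊆-universal; length-mono-≤)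
open import Data.List.Relation.Binary.Permutation.Propositional
  using (_↭_; ↭-sym; ↭-trans; ↭-prep; module PermutationReasoning)
open import Data.List.Relation.Binary.Permutation.Propositional.Properties
  using (All-resp-↭; ∈-resp-↭; ↭-length; shift; drop-∷; ∷↭∷ʳ)
open import Data.Fin using (Fin; toℕ; cast) renaming (zero to fzero; suc to fsuc)
open import Data.Fin.Properties using (toℕ-cast; cast-involutive)
open import Data.Product using (∃; ∃₂; _×_; _,_; proj₁; proj₂; swap)
open import Data.Sum using (inj₁; inj₂)
open import Data.Unit using (⊤; tt)
open import Relation.Nullary using (¬_; contradiction)
open import Function using (_∘_)
open import Relation.Binary.PropositionalEquality using (_≡_; refl; sym; trans; cong; cong₂; subst)

private
  variable
    A : Set

⊆-++⁻ : ∀ (xs ys : List A) {zs} → zs ⊆ xs ++ ys →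
  ∃₂ λ zs₁ zs₂ → zs ≡ zs₁ ++ zs₂ × zs₁ ⊆ xs × zs₂ ⊆ ys
⊆-++⁻ [] ys s = [] , _ , refl , [] , s
⊆-++⁻ (x ∷ xs) ys (.x ∷ʳ s) with ⊆-++⁻ xs ys s
... | zs₁ , zs₂ , refl , s₁ , s₂ = zs₁ , zs₂ , refl , x ∷ʳ s₁ , s₂
⊆-++⁻ (x ∷ xs) ys (x≡z ∷ s) with ⊆-++⁻ xs ys s
... | zs₁ , zs₂ , refl , s₁ , s₂ = _ ∷ zs₁ , zs₂ , refl , x≡z ∷ s₁ , s₂

⊆-init : ∀ (xs : List A) {y ys zs z} → xs ++ y ∷ ys ⊆ zs ++ z ∷ [] → xs ⊆ zs
⊆-init []       {zs = zs} _          = []⊆-universal zs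
⊆-init (_ ∷ _)     {zs = []}     (_ ∷ʳ ())
⊆-init (_ ∷ [])    {zs = []}     (_ ∷ ())
⊆-init (_ ∷ _ ∷ _) {zs = []}     (_ ∷ ())
⊆-init (x ∷ xs)    {zs = z ∷ zs} (.z ∷ʳ s) = z ∷ʳ ⊆-init (x ∷ xs) s
⊆-init (x ∷ xs)    {zs = z ∷ zs} (x≡z ∷ s) = x≡z ∷ ⊆-init xs s

AllPairs-resp-⊆ : ∀ {R : A → A → Set} {xs ys} → xs ⊆ ys → AllPairs R ys → AllPairs R xs
AllPairs-resp-⊆ []         []       = []
AllPairs-resp-⊆ (_ ∷ʳ s)   (_ ∷ ps) = AllPairs-resp-⊆ s ps
AllPairs-resp-⊆ (refl ∷ s) (p ∷ ps) = All-resp-⊆ s p ∷ AllPairs-resp-⊆ s ps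

length-∷ʳ : ∀ (xs : List A) x → length (xs ++ x ∷ []) ≡ suc (length xs)
length-∷ʳ []       x = refl
length-∷ʳ (_ ∷ xs) x = cong suc (length-∷ʳ xs x)

lookup-at-length : ∀ (xs : List A) y zs →
  ∃ λ (j : Fin (length (xs ++ y ∷ zs))) → toℕ j ≡ length xs × lookup (xs ++ y ∷ zs) j ≡ y
lookup-at-length []       y zs = fzero , refl , refl
lookup-at-length (x ∷ xs) y zs with lookup-at-length xs y zs
... | j , j≡ , lookup≡y = fsuc j , cong suc j≡ , lookup≡y

lookup-split : ∀ (xs : List A) j {y} → lookup xs j ≡ y →
  ∃₂ λ ys zs → xs ≡ ys ++ y ∷ zs × length ys ≡ toℕ j
lookup-split (x ∷ xs) fzero    refl = [] , xs , refl , refl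
lookup-split (x ∷ xs) (fsuc j) eq with lookup-split xs j eq
... | ys , zs , refl , len = x ∷ ys , zs , refl , cong suc len

lookup-++-∈ʳ : ∀ (xs : List A) {ys} (j : Fin (length (xs ++ ys))) → length xs ≤ toℕ j →
  lookup (xs ++ ys) j ∈ ys
lookup-++-∈ʳ []       j        _       = ∈-lookup j
lookup-++-∈ʳ (x ∷ xs) (fsuc j) (s≤s h) = lookup-++-∈ʳ xs j h


oneTo-≤ : ∀ m → All (_≤ m) (oneTo m)
oneTo-≤ m = All.map⁺ (All.tabulate ∈-upTo⁻)

oneTo-suc-↭ : ∀ m → oneTo (suc m) ↭ suc m ∷ oneTo m
oneTo-suc-↭ m = subst (_↭ suc m ∷ oneTo m) snoc (↭-sym (∷↭∷ʳ (suc m) (oneTo m)))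
  where
  snoc : oneTo m ++ suc m ∷ [] ≡ oneTo (suc m)
  snoc = trans (sym (map-++ suc (upTo m) (m ∷ []))) (cong (map suc) (upTo-∷ʳ m))

length-oneTo : ∀ m → length (oneTo m) ≡ m
length-oneTo m = trans (length-map suc (upTo m)) (length-upTo m)

top-of-↭-oneTo : ∀ {x zs} m → All (_≤ x) zs → x ∷ zs ↭ oneTo (suc m) → x ≡ suc m
top-of-↭-oneTo {x} m zs≤x p = ≤-antisym x≤top top≤x
  where
  x≤top : x ≤ suc m
  x≤top = All.head (All-resp-↭ (↭-sym p) (oneTo-≤ (suc m)))
  top≤x : suc m ≤ x
  top≤x with ∈-resp-↭ (↭-sym p) (∈-map⁺ suc (∈-upTo⁺ ≤-refl))
  ... | here top≡x = subst (suc m ≤_) top≡x ≤-refl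
  ... | there top∈zs = All.lookup zs≤x top∈zs

-- b + l, …, b + 1; the prefix of φ is definitionally  prefix n i ≡ block (n ∸ i) (i ∸ 1) ++ n ∷ [].
block : ℕ → ℕ → List ℕ
block b l = map (λ j → b + suc j) (downFrom l)

length-block : ∀ b l → length (block b l) ≡ l
length-block b l = trans (length-map _ (downFrom l)) (length-downFrom l)

block-> : ∀ b l → All (b <_) (block b l)
block-> b l = All.map⁺ (All.applyDownFrom⁺₂ _ l (λ _ → m<m+n b z<s))

block-decreasing : ∀ b l → AllPairs _>_ (block b l)
block-decreasing b l = AllPairs.map⁺ (AllPairs.applyDownFrom⁺₁ _ l (λ j<i _ → +-monoʳ-< b (s<s j<i)))

block-++-↭ : ∀ {b ys} l → ys ↭ oneTo b → block b l ++ ys ↭ oneTo (b + l)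
block-++-↭ {b} zero    p = subst (λ m → _ ↭ oneTo m) (sym (+-identityʳ b)) p
block-++-↭ {b} (suc l) p = begin
  b + suc l ∷ block b l ++ _  <⟨ block-++-↭ l p ⟩
  b + suc l ∷ oneTo (b + l)   ≡⟨ cong (λ m → m ∷ oneTo (b + l)) (+-suc b l) ⟩
  suc (b + l) ∷ oneTo (b + l) ↭⟨ oneTo-suc-↭ (b + l) ⟨
  oneTo (suc (b + l))         ≡⟨ cong oneTo (+-suc b l) ⟨
  oneTo (b + suc l)           ∎
  where open PermutationReasoning


Contains-⊆ : ∀ {xs ys pat} → xs ⊆ ys → Contains xs pat → Contains ys pat
Contains-⊆ xs⊆ys (occ , occ⊆xs , iso) = occ , ⊆-trans occ⊆xs xs⊆ys , iso

AvoidsAll-⊆ : ∀ {pats xs ys} → xs ⊆ ys → AvoidsAll pats ys → AvoidsAll pats xs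
AvoidsAll-⊆ xs⊆ys = All.map (λ {pat} avoids → avoids ∘ Contains-⊆ {pat = pat} xs⊆ys)

shorter-avoids : ∀ {xs pat} → length xs < length pat → ¬ Contains xs pat
shorter-avoids short (occ , occ⊆xs , len , _) =
  <-irrefl refl (≤-<-trans (subst (_≤ _) len (length-mono-≤ occ⊆xs)) short)

length-decPat : ∀ k → length (decPat (suc k)) ≡ suc k
length-decPat k = trans (length-∷ʳ (map suc (downFrom k)) (suc k))
                        (cong suc (trans (length-map suc (downFrom k)) (length-downFrom k)))

SameOrder : ℕ → ℕ → ℕ → ℕ → Set
SameOrder a b d e = (a < b → d < e) × (d < e → a < b)

sameOrder : ∀ {a b d e} → a < b → d < e → SameOrder a b d e × SameOrder b a e d
sameOrder a<b d<e =
  ((λ _ → d<e) , (λ _ → a<b)) ,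
  ((λ b<a → contradiction b<a (<-asym a<b)) , (λ e<d → contradiction e<d (<-asym d<e)))

sameOrder-refl : ∀ {a d} → SameOrder a a d d
sameOrder-refl = (λ a<a → contradiction a<a (<-irrefl refl)) ,
                 (λ d<d → contradiction d<d (<-irrefl refl))

orderIso₃ : ∀ {a b c d e f} →
  SameOrder a b d e × SameOrder b a e d → SameOrder a c d f × SameOrder c a f d →
  SameOrder b c e f × SameOrder c b f e → OrderIso (a ∷ b ∷ c ∷ []) (d ∷ e ∷ f ∷ [])
orderIso₃ (ab , ba) (ac , ca) (bc , cb) = refl , same
  where
  same : ∀ (u v : Fin 3) → _
  same fzero               fzero               = sameOrder-refl
  same fzero               (fsuc fzero)        = ab
  same fzero               (fsuc (fsuc fzero)) = ac
  same (fsuc fzero)        fzero               = ba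
  same (fsuc fzero)        (fsuc fzero)        = sameOrder-refl
  same (fsuc fzero)        (fsuc (fsuc fzero)) = bc
  same (fsuc (fsuc fzero)) fzero               = ca
  same (fsuc (fsuc fzero)) (fsuc fzero)        = cb
  same (fsuc (fsuc fzero)) (fsuc (fsuc fzero)) = sameOrder-refl

orderIso-123 : ∀ {a b c} → a < b → b < c → OrderIso (a ∷ b ∷ c ∷ []) (1 ∷ 2 ∷ 3 ∷ [])
orderIso-123 a<b b<c =
  orderIso₃ (sameOrder a<b (s<s z<s)) (sameOrder (<-trans a<b b<c) (s<s z<s)) (sameOrder b<c (s<s (s<s z<s)))

orderIso-132 : ∀ {a b c} → a < c → c < b → OrderIso (a ∷ b ∷ c ∷ []) (1 ∷ 3 ∷ 2 ∷ [])
orderIso-132 a<c c<b =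
  orderIso₃ (sameOrder (<-trans a<c c<b) (s<s z<s)) (sameOrder a<c (s<s z<s)) (swap (sameOrder c<b (s<s (s<s z<s))))

-- The entry matched with e lies in zs, hence below y, whereas the pattern puts e above d.
first-above-tail-¬iso : ∀ {b y r zs d ds e} → b < y → All (_≤ b) zs → length r ≤ length ds → d < e →
  ¬ OrderIso (y ∷ r ++ zs) (d ∷ ds ++ e ∷ [])
first-above-tail-¬iso {b} {y} {r} {zs} {d} {ds} {e} b<y zs≤b r≤ds d<e (len , iso)
  with lookup-at-length (d ∷ ds) e []
... | k , k≡ , pat[k]≡e = <-asym b<y (<-≤-trans y<z z≤b)
  where
  j : Fin (length (y ∷ r ++ zs))
  j = cast (sym len) k
  z≤b : lookup (y ∷ r ++ zs) j ≤ b
  z≤b = All.lookup zs≤b (lookup-++-∈ʳ (y ∷ r) j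
          (subst (suc (length r) ≤_) (sym (trans (toℕ-cast (sym len) k) k≡)) (s≤s r≤ds)))
  y<z : y < lookup (y ∷ r ++ zs) j
  y<z = proj₂ (iso fzero j)
          (subst (d <_) (sym (trans (cong (lookup _) (cast-involutive len (sym len) k)) pat[k]≡e)) d<e)

++-avoids : ∀ {b xs ys d ds e} → d < e → All (b <_) xs → All (_≤ b) ys →
  ¬ Contains xs (d ∷ ds ++ e ∷ []) → ¬ Contains ys (d ∷ ds ++ e ∷ []) →
  ¬ Contains (xs ++ ys) (d ∷ ds ++ e ∷ [])
++-avoids {xs = xs} {ys} {d} {ds} {e} d<e xs>b ys≤b xs-avoids ys-avoids (occ , occ⊆ , iso)
  with ⊆-++⁻ xs ys occ⊆
... | [] , occ₂ , refl , _ , occ₂⊆ys = ys-avoids (occ₂ , occ₂⊆ys , iso)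
... | occ₁ , [] , refl , occ₁⊆xs , _ =
  xs-avoids (occ₁ , occ₁⊆xs , subst (λ o → OrderIso o (d ∷ ds ++ e ∷ [])) (++-identityʳ occ₁) iso)
... | y ∷ r , z ∷ zs , refl , occ₁⊆xs , occ₂⊆ys =
  first-above-tail-¬iso (All.head (All-resp-⊆ occ₁⊆xs xs>b)) (All-resp-⊆ occ₂⊆ys ys≤b) r≤ds d<e iso
  where
  r≤ds : length r ≤ length ds
  r≤ds = ≤-pred (begin
    suc (length r)          ≤⟨ s≤s (length-++-≤ˡ r) ⟩
    suc (length (r ++ zs))  ≡⟨ length-++-sucʳ r z zs ⟨
    length (r ++ z ∷ zs)    ≡⟨ suc-injective (proj₁ iso) ⟩
    length (ds ++ e ∷ [])   ≡⟨ length-∷ʳ ds e ⟩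
    suc (length ds)         ∎)
    where open ≤-Reasoning

descending-++-avoids-ascent : ∀ {xs z a b c rest} → AllPairs _>_ xs → a < b →
  ¬ Contains (xs ++ z ∷ []) (a ∷ b ∷ c ∷ rest)
descending-++-avoids-ascent decr a<b (y₀ ∷ y₁ ∷ y₂ ∷ r , occ⊆ , _ , iso)
  with AllPairs-resp-⊆ (⊆-init (y₀ ∷ y₁ ∷ []) occ⊆) decr
... | (y₀>y₁ ∷ []) ∷ _ = <-asym y₀>y₁ (proj₂ (iso fzero (fsuc fzero)) a<b)


RightMaxima : List ℕ → List ℕ → Set
RightMaxima []       ys = ⊤
RightMaxima (x ∷ xs) ys = All (_≤ x) (xs ++ ys) × RightMaxima xs ys

-- An ascent x < y in front of N completes to a 123 (y before N) or a 132 (y after N).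
avoids-123-132⇒RightMaxima : ∀ {N} xs ys → All (_< N) (xs ++ ys) →
  ¬ Contains (xs ++ N ∷ ys) (1 ∷ 2 ∷ 3 ∷ []) → ¬ Contains (xs ++ N ∷ ys) (1 ∷ 3 ∷ 2 ∷ []) →
  RightMaxima xs ys
avoids-123-132⇒RightMaxima []       ys _        _         _         = tt
avoids-123-132⇒RightMaxima {N} (x ∷ xs) ys (_ ∷ <N) avoid-123 avoid-132 =
  All.tabulate (λ y∈ → ≮⇒≥ (no-ascent y∈)) ,
  avoids-123-132⇒RightMaxima xs ys <N (avoid-123 ∘ Contains-⊆ drop-x) (avoid-132 ∘ Contains-⊆ drop-x)
  where
  drop-x : xs ++ N ∷ ys ⊆ x ∷ xs ++ N ∷ ys
  drop-x = x ∷ʳ ⊆-refl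
  no-ascent : ∀ {y} → y ∈ xs ++ ys → ¬ x < y
  no-ascent y∈ x<y with ∈-++⁻ xs y∈
  ... | inj₁ y∈xs = avoid-123 (_ , refl ∷ ++⁺ (from∈ y∈xs) (refl ∷ []⊆-universal ys) ,
                               orderIso-123 x<y (All.lookup <N y∈))
  ... | inj₂ y∈ys = avoid-132 (_ , refl ∷ ++⁺ˡ xs (refl ∷ from∈ y∈ys) ,
                               orderIso-132 x<y (All.lookup <N y∈))

RightMaxima-↭-block : ∀ b xs {ys} → RightMaxima xs ys → xs ++ ys ↭ oneTo (b + length xs) →
  xs ≡ block b (length xs) × ys ↭ oneTo b
RightMaxima-↭-block b []       {ys} _          p = refl , subst (λ m → ys ↭ oneTo m) (+-identityʳ b) p
RightMaxima-↭-block b (x ∷ xs) {ys} (≤x , rm) p =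
  cong₂ _∷_ (trans x≡top (sym (+-suc b (length xs)))) (proj₁ rest) , proj₂ rest
  where
  p′ : x ∷ xs ++ ys ↭ oneTo (suc (b + length xs))
  p′ = subst (λ m → x ∷ xs ++ ys ↭ oneTo m) (+-suc b (length xs)) p
  x≡top : x ≡ suc (b + length xs)
  x≡top = top-of-↭-oneTo (b + length xs) ≤x p′
  top∷rest : x ∷ xs ++ ys ↭ suc (b + length xs) ∷ oneTo (b + length xs)
  top∷rest = ↭-trans p′ (oneTo-suc-↭ (b + length xs))
  rest : xs ≡ block b (length xs) × ys ↭ oneTo b
  rest = RightMaxima-↭-block b xs rm (drop-∷ (subst (λ v → v ∷ xs ++ ys ↭ _) x≡top top∷rest))


φ-maps-into-Cod : ∀ n k i → suc i ≤ suc k → ∀ σ → Dom n (suc (suc k)) (suc i) σ →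
  Cod n (suc (suc k)) (suc i) (φ n (suc i) σ)
φ-maps-into-Cod n k i i≤k σ (i≤n , σ↭ , avoid-123 ∷ avoid-132 ∷ avoid-dec ∷ []) =
  (π↭ , avoids {ds = 2 ∷ []} (s<s z<s) avoid-123 prefix-avoids-123
      ∷ avoids {ds = 3 ∷ []} (s<s z<s) avoid-132 prefix-avoids-132
      ∷ avoids {ds = map suc (downFrom k)} ≤-refl avoid-dec prefix-avoids-dec ∷ []) ,
  position
  where
  b : ℕ
  b = n ∸ suc i
  top : suc (b + i) ≡ n
  top = trans (sym (+-suc b i)) (m∸n+n≡m i≤n)
  prefix>b : All (b <_) (block b i ++ n ∷ [])
  prefix>b = All.++⁺ (block-> b i) (subst (b <_) top (s≤s (m≤m+n b i)) ∷ [])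
  σ≤b : All (_≤ b) σ
  σ≤b = All-resp-↭ (↭-sym σ↭) (oneTo-≤ b)
  avoids : ∀ {d ds e} → d < e → ¬ Contains σ (d ∷ ds ++ e ∷ []) →
    ¬ Contains (block b i ++ n ∷ []) (d ∷ ds ++ e ∷ []) → ¬ Contains ((block b i ++ n ∷ []) ++ σ) (d ∷ ds ++ e ∷ [])
  avoids d<e σ-avoids prefix-avoids = ++-avoids d<e prefix>b σ≤b prefix-avoids σ-avoids
  prefix-avoids-123 : ¬ Contains (block b i ++ n ∷ []) (1 ∷ 2 ∷ 3 ∷ [])
  prefix-avoids-123 = descending-++-avoids-ascent (block-decreasing b i) (s<s z<s)
  prefix-avoids-132 : ¬ Contains (block b i ++ n ∷ []) (1 ∷ 3 ∷ 2 ∷ [])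
  prefix-avoids-132 = descending-++-avoids-ascent (block-decreasing b i) (s<s z<s)
  prefix-avoids-dec : ¬ Contains (block b i ++ n ∷ []) (decPat (suc (suc k)))
  prefix-avoids-dec = shorter-avoids (begin-strict
    length (block b i ++ n ∷ [])  ≡⟨ length-∷ʳ (block b i) n ⟩
    suc (length (block b i))      ≡⟨ cong suc (length-block b i) ⟩
    suc i                         <⟨ s≤s i≤k ⟩
    suc (suc k)                   ≡⟨ length-decPat (suc k) ⟨
    length (decPat (suc (suc k))) ∎)
    where open ≤-Reasoning
  π↭ : (block b i ++ n ∷ []) ++ σ ↭ oneTo n
  π↭ = begin
    (block b i ++ n ∷ []) ++ σ ≡⟨ ++-assoc (block b i) (n ∷ []) σ ⟩
    block b i ++ n ∷ σ         ↭⟨ shift n (block b i) σ ⟩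
    n ∷ block b i ++ σ         ↭⟨ ↭-prep n (block-++-↭ i σ↭) ⟩
    n ∷ oneTo (b + i)          ≡⟨ cong (_∷ oneTo (b + i)) top ⟨
    suc (b + i) ∷ oneTo (b + i) ↭⟨ oneTo-suc-↭ (b + i) ⟨
    oneTo (suc (b + i))        ≡⟨ cong oneTo top ⟩
    oneTo n                    ∎
    where open PermutationReasoning
  position : PosIs ((block b i ++ n ∷ []) ++ σ) n (suc i)
  position with lookup-at-length (block b i) n σ
  ... | j , j≡ , π[j]≡n = subst (λ π → PosIs π n (suc i)) (sym (++-assoc (block b i) (n ∷ []) σ))
                            (j , cong suc (trans j≡ (length-block b i)) , π[j]≡n)

φ-covers : ∀ n k xs σ → InS (suc n) (R k) (xs ++ suc n ∷ σ) →
  Dom (suc n) k (suc (length xs)) σ × φ (suc n) (suc (length xs)) σ ≡ xs ++ suc n ∷ σ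
φ-covers n k xs σ (π↭ , avoids@(avoid-123 ∷ avoid-132 ∷ _)) =
  (s≤s L≤n , proj₂ blocks , AvoidsAll-⊆ (++⁺ˡ xs (suc n ∷ʳ ⊆-refl)) avoids) ,
  trans (++-assoc (block b L) (suc n ∷ []) σ) (cong (_++ suc n ∷ σ) (sym (proj₁ blocks)))
  where
  L b : ℕ
  L = length xs
  b = n ∸ L
  rest↭ : xs ++ σ ↭ oneTo n
  rest↭ = drop-∷ (begin
    suc n ∷ xs ++ σ   ↭⟨ shift (suc n) xs σ ⟨
    xs ++ suc n ∷ σ   ↭⟨ π↭ ⟩
    oneTo (suc n)     ↭⟨ oneTo-suc-↭ n ⟩
    suc n ∷ oneTo n   ∎)
    where open PermutationReasoning
  L≤n : L ≤ n
  L≤n = subst (L ≤_) (trans (↭-length rest↭) (length-oneTo n)) (length-++-≤ˡ xs)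
  rm : RightMaxima xs σ
  rm = avoids-123-132⇒RightMaxima xs σ (All-resp-↭ (↭-sym rest↭) (All.map s≤s (oneTo-≤ n)))
                                  avoid-123 avoid-132
  blocks : xs ≡ block b L × σ ↭ oneTo b
  blocks = RightMaxima-↭-block b xs rm (subst (λ m → xs ++ σ ↭ oneTo m) (sym (m∸n+n≡m L≤n)) rest↭)

φ-onto-Cod : ∀ n k i π → Cod (suc n) k i π → ∃ λ σ → Dom (suc n) k i σ × φ (suc n) i σ ≡ π
φ-onto-Cod n k .(suc (toℕ j)) π (π∈S , j , refl , π[j]≡n) with lookup-split π j π[j]≡n
... | xs , σ , refl , L≡j =
  σ , subst (λ l → Dom (suc n) k (suc l) σ × φ (suc n) (suc l) σ ≡ xs ++ suc n ∷ σ) L≡j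
            (φ-covers n k xs σ π∈S)

lemma3p11 : ∀ (n k i : ℕ) → 1 ≤ n → 2 ≤ k → 1 ≤ i → i ≤ k ∸ 1 →
    (∀ σ → Dom n k i σ → Cod n k i (φ n i σ)) ×
    (∀ σ τ → Dom n k i σ → Dom n k i τ → φ n i σ ≡ φ n i τ → σ ≡ τ) ×
    (∀ π → Cod n k i π → ∃ λ σ → Dom n k i σ × φ n i σ ≡ π)
lemma3p11 (suc n) (suc (suc k)) (suc i) _ _ _ i≤k =
  φ-maps-into-Cod (suc n) k i i≤k ,
  (λ σ τ _ _ → ++-cancelˡ (prefix (suc n) (suc i)) σ τ) ,
  φ-onto-Cod n (suc (suc k)) (suc i)
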